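{- For every natural number $n$, $$\bar{\tau}(K_n)=\sum_{k=1}^{n}\mathrm{Surj}(n,k)=\sum_{k=1}^{n}S(n,k)\,k!\qquad\text{and}\qquad \hbar(K_n)=2^{n-1},$$ where $\mathrm{Surj}(n,k)$ is the number of surjections from $\{1,\dots,n\}$ onto $\{1,\dots,k\}$ and $S(n,k)$ is the Stirling number of the second kind (the number of partitions of $\{1,\dots,n\}$ into exactly $k$ nonempty blocks).
   Context: $K_n$ is the complete graph on $n$ vertices. For a topology $\mathcal{T}$ on a finite set $X$, its underlying graph is the simple graph on $X$ in which distinct $x,y$ are adjacent iff $x\in\overline{\{y\}}$ or $y\in\overline{\{x\}}$ (closures in $\mathcal{T}$). For a finite simple graph $G$, $\bar{\tau}(G)$ is the number of topologies on $V(G)$ whose underlying graph is exactly $G$, and $\hbar(G)$ is the number of pairwise non-homeomorphic such topologies. -}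

module Defs where

open import Data.Nat using (ℕ; zero; suc; _+_)
open import Data.Bool using (Bool; true; false)
open import Data.Fin using (Fin)
open import Data.Fin.Subset using (Subset; _∈_; _∪_; _∩_; ⊥; ⊤)
open import Data.Fin.Permutation using (Permutation′; _⟨$⟩ˡ_)
open import Data.Vec using (tabulate; lookup)
open import Data.Product using (Σ; ∃; _×_; _,_)
open import Data.Sum using (_⊎_)
open import Relation.Nullary using (¬_)
open import Relation.Binary.PropositionalEquality using (_≡_; _≢_)
open import Function.Bundles using (_⇔_)

-- Finite counting: A has exactly m elements up to the relation _≈_
-- (for _≈_ an equivalence relation this counts equivalence classes).

HasSize : (A : Set) → (A → A → Set) → ℕ → Set
HasSize A _≈_ m =
  Σ (Fin m → A) λ f →
    (∀ (a : A) → ∃ λ i → f i ≈ a) ×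
    (∀ (i j : Fin m) → f i ≈ f j → i ≡ j)

Σ₁ : ℕ → (ℕ → ℕ) → ℕ
Σ₁ zero    f = 0
Σ₁ (suc n) f = Σ₁ n f + f (suc n)

Family : ℕ → Set
Family n = Subset n → Bool

_≐_ : ∀ {n} → Family n → Family n → Set
F ≐ G = ∀ U → F U ≡ G U

Open : ∀ {n} → Family n → Subset n → Set
Open F U = F U ≡ true

-- F is a topology on Fin n (the set is finite, so closure under
-- binary unions and intersections plus ∅, X is the full axiom set)
record IsTopology {n : ℕ} (F : Family n) : Set where
  field
    open-∅ : Open F ⊥
    open-X : Open F ⊤
    open-∪ : ∀ U V → Open F U → Open F V → Open F (U ∪ V)
    open-∩ : ∀ U V → Open F U → Open F V → Open F (U ∩ V)

InClosureOf : ∀ {n} → Family n → Fin n → Fin n → Set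
InClosureOf F x y = ∀ U → Open F U → x ∈ U → y ∈ U

Graph : ℕ → Set₁
Graph n = Fin n → Fin n → Set

CompleteGraph : (n : ℕ) → Graph n
CompleteGraph n x y = x ≢ y

HasUnderlyingGraph : ∀ {n} → Family n → Graph n → Set
HasUnderlyingGraph F G =
  ∀ x y → x ≢ y → (G x y ⇔ (InClosureOf F x y ⊎ InClosureOf F y x))

TopWithGraph : (n : ℕ) → Graph n → Set
TopWithGraph n G = Σ (Family n) λ F → IsTopology F × HasUnderlyingGraph F G

SameTop : ∀ {n} {G : Graph n} → TopWithGraph n G → TopWithGraph n G → Set
SameTop (F , _) (F' , _) = F ≐ F'

image : ∀ {n} → Permutation′ n → Subset n → Subset n
image σ U = tabulate λ y → lookup U (σ ⟨$⟩ˡ y)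

Homeomorphic : ∀ {n} {G : Graph n} → TopWithGraph n G → TopWithGraph n G → Set
Homeomorphic {n} (F , _) (F' , _) =
  Σ (Permutation′ n) λ σ → ∀ U → F U ≡ F' (image σ U)

Surjection : ℕ → ℕ → Set
Surjection n k = Σ (Fin n → Fin k) λ f → ∀ j → ∃ λ i → f i ≡ j

SameFun : ∀ {n k} → Surjection n k → Surjection n k → Set
SameFun (f , _) (g , _) = ∀ i → f i ≡ g i

-- Partitions of Fin n into exactly k nonempty blocks: the blocks are
-- the (nonempty) fibres of a surjection b : Fin n → Fin k; two such
-- labellings give the same partition iff they have the same blocks.
SamePartition : ∀ {n k} → Surjection n k → Surjection n k → Set
SamePartition (b , _) (b' , _) = ∀ i j → (b i ≡ b j) ⇔ (b' i ≡ b' j)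

-- A topology has complete underlying graph exactly when its specialisation
-- preorder x ≼ y ("x lies in the closure of {y}") is total.  On a finite set
-- the open sets are precisely the up-sets of ≼, so such a topology is the
-- up-set topology of a rank f : Fin n → ℕ, and two ranks give the same
-- topology iff they induce the same preorder.  Each preorder has a unique
-- dense ranking, a surjection Fin n → Fin k (an ordered partition into k
-- blocks); hence τ̄(Kₙ) = Σₖ Surj(n,k).  Surjections with the same blocks
-- differ by one of the k! permutations of the labels, so Surj(n,k) =
-- S(n,k)·k!.  Finally, relabelling the points in sorted order of rank makes
-- every such topology homeomorphic to a staircase, determined by the steps
-- w : Vec Bool (n-1) of the sorted rank; the sizes of the open sets recover
-- w, so there are 2^(n-1) homeomorphism classes.

module Submission where

open import Defs
open import Level using (0ℓ)
open import Data.Nat using (ℕ; zero; suc; _+_; _*_; _∸_; _^_; _!; _≤_; _<_; _≤?_; _<?_; z≤n; s≤s; s≤s⁻¹)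
import Data.Nat.Properties as ℕP
open import Data.Fin using (Fin; zero; suc; toℕ; fromℕ<; inject₁; punchIn; punchOut; splitAt; join; _↑ˡ_; _↑ʳ_; combine; remQuot)
  renaming (_<_ to _<ᶠ_)
import Data.Fin.Properties as FinP
open import Data.Fin.Induction using (<-wellFounded)
open import Data.Fin.Subset using (Subset; _∈_; _∉_; _∪_; _∩_; ⊤) renaming (⊥ to ∅)
open import Data.Fin.Subset.Properties using (_∈?_; ∈⊤; ∉⊥; x∈p∩q⁺; x∈p∩q⁻; x∈p∪q⁺; x∈p∪q⁻; ⊆-antisym; anySubset?)
open import Data.Fin.Permutation using (Permutation′; permutation; _⟨$⟩ˡ_; _⟨$⟩ʳ_; inverseˡ; inverseʳ; flip; _∘ₚ_)
  renaming (id to idₚ)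
open import Data.Bool using (Bool; true; false)
open import Data.Bool.Properties using (⇔→≡) renaming (_≟_ to _≟ᵇ_)
open import Data.Vec using (Vec; []; _∷_; tabulate; lookup)
open import Data.Vec.Properties using (lookup∘tabulate; tabulate∘lookup; tabulate-cong; []=⇒lookup; lookup⇒[]=)
open import Data.Product using (Σ; ∃; _×_; _,_; proj₁; proj₂; uncurry)
open import Data.Product.Relation.Binary.Pointwise.NonDependent using () renaming (Pointwise to _×ᴿ_)
open import Data.Product.Relation.Binary.Lex.Strict using (×-strictTotalOrder)
open import Data.Sum using (_⊎_; inj₁; inj₂) renaming (map to ⊎-map)
open import Data.Sum.Relation.Binary.Pointwise using (inj₁; inj₂) renaming (Pointwise to _⊎ᴿ_)
open import Function.Base using (_∘_; _∘′_)
open import Function.Bundles using (_⇔_; mk⇔; Equivalence)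
open import Function.Definitions using (Injective)
open import Induction.WellFounded using (Acc; acc)
open import Relation.Binary.Core using (Rel)
open import Relation.Binary.Bundles using (StrictTotalOrder)
open import Relation.Binary.Definitions using (Symmetric; Transitive; tri<; tri≈; tri>)
open import Relation.Nullary using (Dec; yes; no; does; ¬_; contradiction)
open import Relation.Nullary.Decidable using (_×-dec_; _→-dec_; ¬?; dec-true; dec-false)
open import Relation.Binary.PropositionalEquality

classIndex-injective : {A : Set} {_≈_ : Rel A 0ℓ} → Symmetric _≈_ → Transitive _≈_ →
  ∀ {m m'} (f : Fin m → A) {g : Fin m' → A} (g-onto : ∀ a → ∃ λ j → g j ≈ a) →
  (∀ i i' → f i ≈ f i' → i ≡ i') → Injective _≡_ _≡_ (λ i → proj₁ (g-onto (f i)))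
classIndex-injective {_≈_ = _≈_} sym≈ trans≈ f {g} g-onto f-inj {i} {i'} same =
  f-inj i i' (trans≈ (sym≈ (proj₂ (g-onto (f i))))
                     (subst (λ j → g j ≈ f i') (sym same) (proj₂ (g-onto (f i')))))

size-unique : {A : Set} {_≈_ : Rel A 0ℓ} → Symmetric _≈_ → Transitive _≈_ →
  ∀ {m m'} → HasSize A _≈_ m → HasSize A _≈_ m' → m ≡ m'
size-unique sym≈ trans≈ (f , f-onto , f-inj) (g , g-onto , g-inj) =
  FinP.cantor-schröder-bernstein (classIndex-injective sym≈ trans≈ f g-onto f-inj)
                                 (classIndex-injective sym≈ trans≈ g f-onto g-inj)

size-transport : {A B : Set} {_≈ᴬ_ : Rel A 0ℓ} {_≈ᴮ_ : Rel B 0ℓ} → Transitive _≈ᴮ_ →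
  (φ : A → B) → (∀ a a' → a ≈ᴬ a' → φ a ≈ᴮ φ a') → (∀ a a' → φ a ≈ᴮ φ a' → a ≈ᴬ a') →
  (∀ b → ∃ λ a → φ a ≈ᴮ b) → ∀ {m} → HasSize A _≈ᴬ_ m → HasSize B _≈ᴮ_ m
size-transport trans≈ φ preserve reflect φ-onto (f , f-onto , f-inj) =
  (λ i → φ (f i)) ,
  (λ b → let (a , φa≈b) = φ-onto b ; (i , fi≈a) = f-onto a in i , trans≈ (preserve _ _ fi≈a) φa≈b) ,
  (λ i i' φfi≈φfi' → f-inj i i' (reflect _ _ φfi≈φfi'))

size-Fin : ∀ t → HasSize (Fin t) _≡_ t
size-Fin t = (λ i → i) , (λ i → i , refl) , (λ i i' eq → eq)

size-⊎ : {A B : Set} {R : Rel A 0ℓ} {S : Rel B 0ℓ} {a b : ℕ} →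
  HasSize A R a → HasSize B S b → HasSize (A ⊎ B) (R ⊎ᴿ S) (a + b)
size-⊎ {A} {B} {R} {S} {a} {b} (f , f-onto , f-inj) (g , g-onto , g-inj) = h , h-onto , h-inj
  where
  h⊎ : Fin a ⊎ Fin b → A ⊎ B
  h⊎ (inj₁ i) = inj₁ (f i)
  h⊎ (inj₂ j) = inj₂ (g j)
  h : Fin (a + b) → A ⊎ B
  h i = h⊎ (splitAt a i)
  h-onto : ∀ x → ∃ λ i → (R ⊎ᴿ S) (h i) x
  h-onto (inj₁ x) = let (i , fi≈x) = f-onto x in
    i ↑ˡ b , subst (λ s → (R ⊎ᴿ S) (h⊎ s) (inj₁ x)) (sym (FinP.splitAt-↑ˡ a i b)) (inj₁ fi≈x)
  h-onto (inj₂ y) = let (j , gj≈y) = g-onto y in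
    a ↑ʳ j , subst (λ s → (R ⊎ᴿ S) (h⊎ s) (inj₂ y)) (sym (FinP.splitAt-↑ʳ a b j)) (inj₂ gj≈y)
  split-inj : ∀ s s' → (R ⊎ᴿ S) (h⊎ s) (h⊎ s') → s ≡ s'
  split-inj (inj₁ i) (inj₁ i') (inj₁ r) = cong inj₁ (f-inj i i' r)
  split-inj (inj₂ j) (inj₂ j') (inj₂ r) = cong inj₂ (g-inj j j' r)
  h-inj : ∀ i i' → (R ⊎ᴿ S) (h i) (h i') → i ≡ i'
  h-inj i i' r = begin
    i                       ≡⟨ FinP.join-splitAt a b i ⟨
    join a b (splitAt a i)  ≡⟨ cong (join a b) (split-inj _ _ r) ⟩
    join a b (splitAt a i') ≡⟨ FinP.join-splitAt a b i' ⟩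
    i'                      ∎
    where open ≡-Reasoning

size-pairs : {A : Set} {R : Rel A 0ℓ} {s c : ℕ} (E : Fin s × Fin c → A) →
  (∀ a → ∃ λ pq → R (E pq) a) → (∀ pq pq' → R (E pq) (E pq') → pq ≡ pq') →
  HasSize A R (s * c)
size-pairs {A} {R} {s} {c} E E-onto E-inj = E∘remQuot , onto , inj
  where
  E∘remQuot : Fin (s * c) → A
  E∘remQuot i = E (remQuot c i)
  onto : ∀ a → ∃ λ i → R (E∘remQuot i) a
  onto a = let ((p , q) , r) = E-onto a in
    combine p q , subst (λ pq → R (E pq) a) (sym (FinP.remQuot-combine p q)) r
  inj : ∀ i i' → R (E∘remQuot i) (E∘remQuot i') → i ≡ i'
  inj i i' r = begin
    i                        ≡⟨ FinP.combine-remQuot {s} c i ⟨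
    pair (remQuot c i)       ≡⟨ cong pair (E-inj _ _ r) ⟩
    pair (remQuot c i')      ≡⟨ FinP.combine-remQuot {s} c i' ⟩
    i'                       ∎
    where
    open ≡-Reasoning
    pair : Fin s × Fin c → Fin (s * c)
    pair = uncurry combine

size-× : {A B : Set} {R : Rel A 0ℓ} {S : Rel B 0ℓ} {a b : ℕ} →
  HasSize A R a → HasSize B S b → HasSize (A × B) (R ×ᴿ S) (a * b)
size-× {R = R} {S} (f , f-onto , f-inj) (g , g-onto , g-inj) =
  size-pairs {R = R ×ᴿ S} (λ (p , q) → f p , g q)
    (λ (x , y) → let (p , fp≈x) = f-onto x ; (q , gq≈y) = g-onto y in (p , q) , fp≈x , gq≈y)
    (λ (p , q) (p' , q') (r₁ , r₂) → cong₂ _,_ (f-inj p p' r₁) (g-inj q q' r₂))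

size-fibred : {A : Set} {R S : Rel A 0ℓ} {s c : ℕ} →
  (∀ {a b} → R a b → S a b) → Symmetric S → Transitive S →
  HasSize A S s →
  (∀ a → HasSize (Σ A λ a' → S a' a) (λ x y → R (proj₁ x) (proj₁ y)) c) →
  HasSize A R (s * c)
size-fibred {A} {R} {S} {s} {c} R⊆S symS transS (g , g-onto , g-inj) fibre =
  size-pairs {R = R} E E-onto E-inj
  where
  E : Fin s × Fin c → A
  E (p , q) = proj₁ (proj₁ (fibre (g p)) q)
  E-onto : ∀ a → ∃ λ pq → R (E pq) a
  E-onto a = let (p , gp≈a) = g-onto a ; (_ , fibre-onto , _) = fibre (g p)
                 (q , r) = fibre-onto (a , symS gp≈a) in (p , q) , r
  E-class : ∀ p q → S (E (p , q)) (g p)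
  E-class p q = proj₂ (proj₁ (fibre (g p)) q)
  E-inj : ∀ pq pq' → R (E pq) (E pq') → pq ≡ pq'
  E-inj (p , q) (p' , q') r
    with refl ← g-inj p p' (transS (symS (E-class p q)) (transS (R⊆S r) (E-class p' q'))) =
    cong (p ,_) (proj₂ (proj₂ (fibre (g p))) q q' r)

Σ≤ : (ℕ → Set) → ℕ → Set
Σ≤ B N = Σ ℕ λ k → (1 ≤ k) × (k ≤ N) × B k

SameΣ : {B : ℕ → Set} → (∀ {k k'} → B k → B k' → Set) → ∀ {N} → Rel (Σ≤ B N) 0ℓ
SameΣ R (k , _ , _ , b) (k' , _ , _ , b') = (k ≡ k') × R b b'

size-Σ≤ : {B : ℕ → Set} {R : ∀ {k k'} → B k → B k' → Set} {c : ℕ → ℕ} →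
  (∀ {k} (b : B k) → R b b) →
  (∀ {k k' k''} {b : B k} {b' : B k'} {b'' : B k''} → R b b' → R b' b'' → R b b'') →
  (∀ k → HasSize (B k) R (c k)) → ∀ N → HasSize (Σ≤ B N) (SameΣ R) (Σ₁ N c)
size-Σ≤ R-refl R-trans size zero =
  (λ ()) , (λ (_ , 1≤k , k≤0 , _) → contradiction (ℕP.≤-trans 1≤k k≤0) λ ()) , (λ ())
size-Σ≤ {B} {R} R-refl R-trans size (suc N) =
  size-transport {_≈ᴬ_ = SameΣ R ⊎ᴿ R} {_≈ᴮ_ = SameΣ R}
    (λ (e , r) (e' , r') → trans e e' , R-trans r r') φ preserve reflect onto
    (size-⊎ (size-Σ≤ R-refl R-trans size N) (size (suc N)))
  where
  φ : Σ≤ B N ⊎ B (suc N) → Σ≤ B (suc N)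
  φ (inj₁ (k , 1≤k , k≤N , b)) = k , 1≤k , ℕP.m≤n⇒m≤1+n k≤N , b
  φ (inj₂ b)                   = suc N , s≤s z≤n , ℕP.≤-refl , b
  preserve : ∀ x y → (SameΣ R ⊎ᴿ R) x y → SameΣ R (φ x) (φ y)
  preserve _ _ (inj₁ r) = r
  preserve _ _ (inj₂ r) = refl , r
  reflect : ∀ x y → SameΣ R (φ x) (φ y) → (SameΣ R ⊎ᴿ R) x y
  reflect (inj₁ _)                 (inj₁ _)                 r          = inj₁ r
  reflect (inj₂ _)                 (inj₂ _)                 (_ , r)    = inj₂ r
  reflect (inj₁ (_ , _ , k≤N , _)) (inj₂ _)                 (refl , _) = contradiction k≤N ℕP.1+n≰n
  reflect (inj₂ _)                 (inj₁ (_ , _ , k≤N , _)) (refl , _) = contradiction k≤N ℕP.1+n≰n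
  onto : ∀ y → ∃ λ x → SameΣ R (φ x) y
  onto (k , 1≤k , k≤1+N , b) with k ℕP.≟ suc N
  ... | yes refl = inj₂ b , refl , R-refl b
  ... | no  k≢1+N = inj₁ (k , 1≤k , s≤s⁻¹ (ℕP.≤∧≢⇒< k≤1+N k≢1+N) , b) , refl , R-refl b

bit : Bool → ℕ
bit true  = 1
bit false = 0

count : ∀ {n} → (Fin n → Bool) → ℕ
count {zero}  p = 0
count {suc n} p = bit (p zero) + count (p ∘ suc)

_⊆ᵇ_ : ∀ {n} → (Fin n → Bool) → (Fin n → Bool) → Set
p ⊆ᵇ q = ∀ x → p x ≡ true → q x ≡ true

bit-mono : ∀ {a b} → (a ≡ true → b ≡ true) → bit a ≤ bit b
bit-mono {false}         _    = z≤n
bit-mono {true}  {true}  _    = s≤s z≤n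
bit-mono {true}  {false} a⇒b with a⇒b refl
... | ()

count-mono : ∀ {n} (p q : Fin n → Bool) → p ⊆ᵇ q → count p ≤ count q
count-mono {zero}  p q p⊆q = z≤n
count-mono {suc n} p q p⊆q =
  ℕP.+-mono-≤ (bit-mono (p⊆q zero)) (count-mono (p ∘ suc) (q ∘ suc) (p⊆q ∘ suc))

count-strict : ∀ {n} (p q : Fin n → Bool) → p ⊆ᵇ q →
  ∀ x → q x ≡ true → p x ≡ false → count p < count q
count-strict {suc n} p q p⊆q zero qx px rewrite qx | px =
  s≤s (count-mono (p ∘ suc) (q ∘ suc) (p⊆q ∘ suc))
count-strict {suc n} p q p⊆q (suc x) qx px =
  ℕP.+-mono-≤-< (bit-mono (p⊆q zero)) (count-strict (p ∘ suc) (q ∘ suc) (p⊆q ∘ suc) x qx px)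

count-cong : ∀ {n} (p q : Fin n → Bool) → (∀ x → p x ≡ q x) → count p ≡ count q
count-cong {zero}  p q p≗q = refl
count-cong {suc n} p q p≗q = cong₂ _+_ (cong bit (p≗q zero)) (count-cong (p ∘ suc) (q ∘ suc) (p≗q ∘ suc))

count≤n : ∀ {n} (p : Fin n → Bool) → count p ≤ n
count≤n {zero}  p = z≤n
count≤n {suc n} p = ℕP.+-mono-≤ (bit≤1 (p zero)) (count≤n (p ∘ suc))
  where
  bit≤1 : ∀ b → bit b ≤ 1
  bit≤1 true  = s≤s z≤n
  bit≤1 false = z≤n

count-all : ∀ n → count {n} (λ _ → true) ≡ n
count-all zero    = refl
count-all (suc n) = cong suc (count-all n)

Members : ∀ {n} → (Fin n → Bool) → Set
Members {n} p = Σ (Fin n) λ x → p x ≡ true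

SameMember : ∀ {n} {p : Fin n → Bool} → Members p → Members p → Set
SameMember a b = proj₁ a ≡ proj₁ b

size-members : ∀ {n} (p : Fin n → Bool) → HasSize (Members p) SameMember (count p)
size-members {zero}  p = (λ ()) , (λ ()) , (λ ())
size-members {suc n} p with p zero in p0 | size-members (p ∘ suc)
... | true  | (f , f-onto , f-inj) = g , g-onto , g-inj
  where
  g : Fin (suc (count (p ∘ suc))) → Members p
  g zero    = zero , p0
  g (suc i) = suc (proj₁ (f i)) , proj₂ (f i)
  g-onto : ∀ a → ∃ λ i → SameMember (g i) a
  g-onto (zero  , _)  = zero , refl
  g-onto (suc x , px) = let (i , fi≡x) = f-onto (x , px) in suc i , cong suc fi≡x
  g-inj : ∀ i j → SameMember (g i) (g j) → i ≡ j
  g-inj zero    zero    _  = refl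
  g-inj zero    (suc j) ()
  g-inj (suc i) zero    ()
  g-inj (suc i) (suc j) eq = cong suc (f-inj i j (FinP.suc-injective eq))
... | false | (f , f-onto , f-inj) = g , g-onto , g-inj
  where
  g : Fin (count (p ∘ suc)) → Members p
  g i = suc (proj₁ (f i)) , proj₂ (f i)
  g-onto : ∀ a → ∃ λ i → SameMember (g i) a
  g-onto (zero  , pz) with () ← trans (sym pz) p0
  g-onto (suc x , px) = let (i , fi≡x) = f-onto (x , px) in i , cong suc fi≡x
  g-inj : ∀ i j → SameMember (g i) (g j) → i ≡ j
  g-inj i j eq = f-inj i j (FinP.suc-injective eq)

count-bij : ∀ {n m} (p : Fin n → Bool) (q : Fin m → Bool) (g : Fin n → Fin m) (h : Fin m → Fin n) →
  (∀ y → g (h y) ≡ y) → (∀ x → h (g x) ≡ x) → (∀ x → q (g x) ≡ p x) → count p ≡ count q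
count-bij p q g h gh hg qg =
  size-unique sym trans
    (size-transport trans g′ (λ _ _ → cong g) (λ _ _ eq → trans (sym (hg _)) (trans (cong h eq) (hg _)))
      (λ (y , qy) → (h y , trans (sym (qg (h y))) (trans (cong q (gh y)) qy)) , gh y)
      (size-members p))
    (size-members q)
  where
  g′ : Members p → Members q
  g′ (x , px) = g x , trans (qg x) px

fromDoes : ∀ {A : Set} (a? : Dec A) → does a? ≡ true → A
fromDoes (yes a) _ = a

≡-from-⇔ : ∀ {a b : Bool} → (a ≡ true → b ≡ true) → (b ≡ true → a ≡ true) → a ≡ b
≡-from-⇔ a⇒b b⇒a = ⇔→≡ (mk⇔ a⇒b b⇒a)

∈⇔lookup : ∀ {n} (U : Subset n) z → z ∈ U ⇔ lookup U z ≡ true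
∈⇔lookup U z = mk⇔ []=⇒lookup (lookup⇒[]= z U)

∈-tabulate : ∀ {n} (p : Fin n → Bool) z → z ∈ tabulate p ⇔ p z ≡ true
∈-tabulate p z = mk⇔
  (λ z∈ → trans (sym (lookup∘tabulate p z)) (Equivalence.to (∈⇔lookup _ z) z∈))
  (λ pz → Equivalence.from (∈⇔lookup _ z) (trans (lookup∘tabulate p z) pz))

CompleteTop : ℕ → Set
CompleteTop n = TopWithGraph n (CompleteGraph n)

UpSet : ∀ {n} → (Fin n → ℕ) → Subset n → Set
UpSet f U = ∀ x y → x ∈ U → f x ≤ f y → y ∈ U

upSet? : ∀ {n} (f : Fin n → ℕ) U → Dec (UpSet f U)
upSet? f U = FinP.all? λ x → FinP.all? λ y → (x ∈? U) →-dec ((f x ≤? f y) →-dec (y ∈? U))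

upSets : ∀ {n} → (Fin n → ℕ) → Family n
upSets f U = does (upSet? f U)

open⇒upSet : ∀ {n} (f : Fin n → ℕ) U → Open (upSets f) U → UpSet f U
open⇒upSet f U = fromDoes (upSet? f U)

upSet⇒open : ∀ {n} (f : Fin n → ℕ) U → UpSet f U → Open (upSets f) U
upSet⇒open f U = dec-true (upSet? f U)

upSets-isTopology : ∀ {n} (f : Fin n → ℕ) → IsTopology (upSets f)
upSets-isTopology f = record
  { open-∅ = upSet⇒open f _ λ x y x∈∅ _ → contradiction x∈∅ ∉⊥
  ; open-X = upSet⇒open f _ λ x y _ _ → ∈⊤
  ; open-∪ = λ U V U-open V-open → upSet⇒open f _ λ x y x∈U∪V fx≤fy → x∈p∪q⁺
      (⊎-map (λ x∈U → open⇒upSet f U U-open x y x∈U fx≤fy)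
             (λ x∈V → open⇒upSet f V V-open x y x∈V fx≤fy) (x∈p∪q⁻ U V x∈U∪V))
  ; open-∩ = λ U V U-open V-open → upSet⇒open f _ λ x y x∈U∩V fx≤fy →
      let (x∈U , x∈V) = x∈p∩q⁻ U V x∈U∩V in
      x∈p∩q⁺ (open⇒upSet f U U-open x y x∈U fx≤fy , open⇒upSet f V V-open x y x∈V fx≤fy)
  }

upSets-closure : ∀ {n} (f : Fin n → ℕ) x y → InClosureOf (upSets f) x y ⇔ f x ≤ f y
upSets-closure f x y = mk⇔ closure⇒≤ (λ fx≤fy U U-open x∈U → open⇒upSet f U U-open x y x∈U fx≤fy)
  where
  -- the principal up-set of x is open and contains x
  above : Fin _ → Bool
  above z = does (f x ≤? f z)
  above-open : Open (upSets f) (tabulate above)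
  above-open = upSet⇒open f _ λ z w z∈ fz≤fw → Equivalence.from (∈-tabulate above w)
    (dec-true (f x ≤? f w) (ℕP.≤-trans (fromDoes (f x ≤? f z) (Equivalence.to (∈-tabulate above z) z∈)) fz≤fw))
  closure⇒≤ : InClosureOf (upSets f) x y → f x ≤ f y
  closure⇒≤ x≼y = fromDoes (f x ≤? f y) (Equivalence.to (∈-tabulate above y)
    (x≼y _ above-open (Equivalence.from (∈-tabulate above x) (dec-true (f x ≤? f x) ℕP.≤-refl))))

upSets-complete : ∀ {n} (f : Fin n → ℕ) → HasUnderlyingGraph (upSets f) (CompleteGraph n)
upSets-complete f x y x≢y = mk⇔ (λ _ → comparable (ℕP.≤-total (f x) (f y))) (λ _ → x≢y)
  where
  comparable : f x ≤ f y ⊎ f y ≤ f x → InClosureOf (upSets f) x y ⊎ InClosureOf (upSets f) y x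
  comparable (inj₁ fx≤fy) = inj₁ (Equivalence.from (upSets-closure f x y) fx≤fy)
  comparable (inj₂ fy≤fx) = inj₂ (Equivalence.from (upSets-closure f y x) fy≤fx)

rankTop : ∀ {n} → (Fin n → ℕ) → CompleteTop n
rankTop f = upSets f , upSets-isTopology f , upSets-complete f

SameOrder : ∀ {n} → (Fin n → ℕ) → (Fin n → ℕ) → Set
SameOrder f g = ∀ x y → f x ≤ f y ⇔ g x ≤ g y

upSets-cong : ∀ {n} (f g : Fin n → ℕ) → SameOrder f g → upSets f ≐ upSets g
upSets-cong f g f∼g U = ≡-from-⇔
  (λ U-open → upSet⇒open g U λ x y x∈U gx≤gy →
     open⇒upSet f U U-open x y x∈U (Equivalence.from (f∼g x y) gx≤gy))
  (λ U-open → upSet⇒open f U λ x y x∈U fx≤fy →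
     open⇒upSet g U U-open x y x∈U (Equivalence.to (f∼g x y) fx≤fy))

upSets-sameOrder : ∀ {n} (f g : Fin n → ℕ) → upSets f ≐ upSets g → SameOrder f g
upSets-sameOrder f g f≐g x y = mk⇔ (transport f≐g) (transport (λ U → sym (f≐g U)))
  where
  transport : ∀ {h h'} → upSets h ≐ upSets h' → h x ≤ h y → h' x ≤ h' y
  transport {h} {h'} h≐h' hx≤hy = Equivalence.to (upSets-closure h' x y)
    λ U U-open → Equivalence.from (upSets-closure h x y) hx≤hy U (trans (h≐h' U) U-open)

∈-image : ∀ {n} (σ : Permutation′ n) U y → y ∈ image σ U ⇔ (σ ⟨$⟩ˡ y) ∈ U
∈-image σ U y = mk⇔
  (λ y∈ → Equivalence.from (∈⇔lookup U _) (Equivalence.to (∈-tabulate _ y) y∈))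
  (λ σy∈ → Equivalence.from (∈-tabulate _ y) (Equivalence.to (∈⇔lookup U _) σy∈))

upSets-image : ∀ {n} (f : Fin n → ℕ) (σ : Permutation′ n) U →
  upSets f U ≡ upSets (λ y → f (σ ⟨$⟩ˡ y)) (image σ U)
upSets-image f σ U = ≡-from-⇔
  (λ U-open → upSet⇒open g _ λ x y x∈ gx≤gy → Equivalence.from (∈-image σ U y)
     (open⇒upSet f U U-open _ _ (Equivalence.to (∈-image σ U x) x∈) gx≤gy))
  (λ σU-open → upSet⇒open f U λ x y x∈U fx≤fy → backward
     (open⇒upSet g _ σU-open _ _ (forward x∈U) (subst₂ _≤_ (sym (g∘σ x)) (sym (g∘σ y)) fx≤fy)))
  where
  g : Fin _ → ℕ
  g y = f (σ ⟨$⟩ˡ y)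
  g∘σ : ∀ x → g (σ ⟨$⟩ʳ x) ≡ f x
  g∘σ x = cong f (inverseˡ σ)
  forward : ∀ {x} → x ∈ U → (σ ⟨$⟩ʳ x) ∈ image σ U
  forward x∈U = Equivalence.from (∈-image σ U _) (subst (_∈ U) (sym (inverseˡ σ)) x∈U)
  backward : ∀ {x} → (σ ⟨$⟩ʳ x) ∈ image σ U → x ∈ U
  backward σx∈ = subst (_∈ U) (inverseˡ σ) (Equivalence.to (∈-image σ U _) σx∈)

⋂ᶠ : ∀ {m n} → (Fin m → Subset n) → Subset n
⋂ᶠ {zero}  V = ⊤
⋂ᶠ {suc m} V = V zero ∩ ⋂ᶠ (V ∘ suc)

⋃ᶠ : ∀ {m n} → (Fin m → Subset n) → Subset n
⋃ᶠ {zero}  V = ∅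
⋃ᶠ {suc m} V = V zero ∪ ⋃ᶠ (V ∘ suc)

∈-⋂ᶠ : ∀ {m n} (V : Fin m → Subset n) y → y ∈ ⋂ᶠ V ⇔ (∀ i → y ∈ V i)
∈-⋂ᶠ {m} V y = mk⇔ (to V) (from V)
  where
  to : ∀ {m} (V : Fin m → Subset _) → y ∈ ⋂ᶠ V → ∀ i → y ∈ V i
  to V y∈ zero    = proj₁ (x∈p∩q⁻ (V zero) _ y∈)
  to V y∈ (suc i) = to (V ∘ suc) (proj₂ (x∈p∩q⁻ (V zero) _ y∈)) i
  from : ∀ {m} (V : Fin m → Subset _) → (∀ i → y ∈ V i) → y ∈ ⋂ᶠ V
  from {zero}  V _   = ∈⊤
  from {suc m} V y∈V = x∈p∩q⁺ (y∈V zero , from (V ∘ suc) (y∈V ∘ suc))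

∈-⋃ᶠ : ∀ {m n} (V : Fin m → Subset n) y → y ∈ ⋃ᶠ V ⇔ (∃ λ i → y ∈ V i)
∈-⋃ᶠ {m} V y = mk⇔ (to V) (λ (i , y∈Vi) → from V i y∈Vi)
  where
  to : ∀ {m} (V : Fin m → Subset _) → y ∈ ⋃ᶠ V → ∃ λ i → y ∈ V i
  to {zero}  V y∈ = contradiction y∈ ∉⊥
  to {suc m} V y∈ with x∈p∪q⁻ (V zero) _ y∈
  ... | inj₁ y∈V0 = zero , y∈V0
  ... | inj₂ y∈⋃  = let (i , y∈Vi) = to (V ∘ suc) y∈⋃ in suc i , y∈Vi
  from : ∀ {m} (V : Fin m → Subset _) i → y ∈ V i → y ∈ ⋃ᶠ V
  from V zero    y∈ = x∈p∪q⁺ (inj₁ y∈)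
  from V (suc i) y∈ = x∈p∪q⁺ (inj₂ (from (V ∘ suc) i y∈))

-- Finite topologies: the specialisation preorder x ≼ y (x lies in the
-- closure of {y}) is decidable, every point has a smallest open
-- neighbourhood {y | x ≼ y}, and the open sets are exactly the up-sets of ≼.
module FiniteTopology {n : ℕ} (F : Family n) (top : IsTopology F) where
  open IsTopology top

  _≼_ : Fin n → Fin n → Set
  _≼_ = InClosureOf F

  ≼-refl : ∀ x → x ≼ x
  ≼-refl x U _ x∈U = x∈U

  ≼-trans : ∀ {x y z} → x ≼ y → y ≼ z → x ≼ z
  ≼-trans x≼y y≼z U U-open x∈U = y≼z U U-open (x≼y U U-open x∈U)

  ⋂ᶠ-open : ∀ {m} (V : Fin m → Subset n) → (∀ i → Open F (V i)) → Open F (⋂ᶠ V)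
  ⋂ᶠ-open {zero}  V _      = open-X
  ⋂ᶠ-open {suc m} V V-open = open-∩ _ _ (V-open zero) (⋂ᶠ-open (V ∘ suc) (V-open ∘ suc))

  ⋃ᶠ-open : ∀ {m} (V : Fin m → Subset n) → (∀ i → Open F (V i)) → Open F (⋃ᶠ V)
  ⋃ᶠ-open {zero}  V _      = open-∅
  ⋃ᶠ-open {suc m} V V-open = open-∪ _ _ (V-open zero) (⋃ᶠ-open (V ∘ suc) (V-open ∘ suc))

  Separated : Fin n → Fin n → Set
  Separated x y = ∃ λ U → Open F U × x ∈ U × y ∉ U

  separated? : ∀ x y → Dec (Separated x y)
  separated? x y = anySubset? λ U → (F U ≟ᵇ true) ×-dec ((x ∈? U) ×-dec ¬? (y ∈? U))

  ¬separated⇒≼ : ∀ {x y} → ¬ Separated x y → x ≼ y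
  ¬separated⇒≼ {x} {y} ¬sep U U-open x∈U with y ∈? U
  ... | yes y∈U = y∈U
  ... | no  y∉U = contradiction (U , U-open , x∈U , y∉U) ¬sep

  _≼?_ : ∀ x y → Dec (x ≼ y)
  x ≼? y with separated? x y
  ... | yes (U , U-open , x∈U , y∉U) = no λ x≼y → y∉U (x≼y U U-open x∈U)
  ... | no  ¬sep                     = yes (¬separated⇒≼ ¬sep)

  -- An open set containing x that separates y from x whenever possible.
  separator : Fin n → Fin n → Subset n
  separator x y with separated? x y
  ... | yes (U , _) = U
  ... | no  _       = ⊤

  separator-open : ∀ x y → Open F (separator x y)
  separator-open x y with separated? x y
  ... | yes (_ , U-open , _) = U-open
  ... | no  _                = open-X

  ∈-separator : ∀ x y → x ∈ separator x y
  ∈-separator x y with separated? x y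
  ... | yes (_ , _ , x∈U , _) = x∈U
  ... | no  _                 = ∈⊤

  separator-excludes : ∀ x y → y ∈ separator x y → x ≼ y
  separator-excludes x y y∈ with separated? x y
  ... | yes (_ , _ , _ , y∉U) = contradiction y∈ y∉U
  ... | no  ¬sep              = ¬separated⇒≼ ¬sep

  -- The smallest open neighbourhood of x.
  nbhd : Fin n → Subset n
  nbhd x = ⋂ᶠ (separator x)

  nbhd-open : ∀ x → Open F (nbhd x)
  nbhd-open x = ⋂ᶠ-open (separator x) (separator-open x)

  ∈-nbhd : ∀ x y → y ∈ nbhd x ⇔ x ≼ y
  ∈-nbhd x y = mk⇔
    (λ y∈ → separator-excludes x y (Equivalence.to (∈-⋂ᶠ (separator x) y) y∈ y))
    (λ x≼y → Equivalence.from (∈-⋂ᶠ (separator x) y)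
               λ z → x≼y (separator x z) (separator-open x z) (∈-separator x z))

  -- Up-sets of the specialisation preorder are open: unions of neighbourhoods.
  upSet-open : ∀ U → (∀ x y → x ∈ U → x ≼ y → y ∈ U) → Open F U
  upSet-open U up = subst (Open F) ⋃≡U (⋃ᶠ-open nbhdIn nbhdIn-open)
    where
    nbhdIn : Fin n → Subset n
    nbhdIn x with x ∈? U
    ... | yes _ = nbhd x
    ... | no  _ = ∅
    nbhdIn-open : ∀ x → Open F (nbhdIn x)
    nbhdIn-open x with x ∈? U
    ... | yes _ = nbhd-open x
    ... | no  _ = open-∅
    nbhdIn⊆U : ∀ x y → y ∈ nbhdIn x → y ∈ U
    nbhdIn⊆U x y y∈ with x ∈? U
    ... | yes x∈U = up x y x∈U (Equivalence.to (∈-nbhd x y) y∈)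
    ... | no  _   = contradiction y∈ ∉⊥
    U⊆nbhdIn : ∀ y → y ∈ U → y ∈ nbhdIn y
    U⊆nbhdIn y y∈U with y ∈? U
    ... | yes _   = Equivalence.from (∈-nbhd y y) (≼-refl y)
    ... | no  y∉U = contradiction y∈U y∉U
    ⋃≡U : ⋃ᶠ nbhdIn ≡ U
    ⋃≡U = ⊆-antisym
      (λ {y} y∈ → let (x , y∈x) = Equivalence.to (∈-⋃ᶠ nbhdIn y) y∈ in nbhdIn⊆U x y y∈x)
      (λ {y} y∈U → Equivalence.from (∈-⋃ᶠ nbhdIn y) (y , U⊆nbhdIn y y∈U))

-- A topology with complete underlying graph has a total specialisation
-- preorder, so it is the up-set topology of the rank x ↦ #{y | y ≼ x}.
module CompleteTopology {n : ℕ} (F : Family n) (top : IsTopology F)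
                        (complete : HasUnderlyingGraph F (CompleteGraph n)) where
  open FiniteTopology F top

  ≼-total : ∀ x y → x ≼ y ⊎ y ≼ x
  ≼-total x y with x FinP.≟ y
  ... | yes refl = inj₁ (≼-refl x)
  ... | no  x≢y  = Equivalence.to (complete x y x≢y) x≢y

  rank : Fin n → ℕ
  rank x = count λ y → does (y ≼? x)

  rank-mono : ∀ {x y} → x ≼ y → rank x ≤ rank y
  rank-mono {x} {y} x≼y = count-mono _ _ λ z z≼x →
    dec-true (z ≼? y) (≼-trans (fromDoes (z ≼? x) z≼x) x≼y)

  -- If x ⋠ y then y ≼ x, and x is counted in rank x but not in rank y.
  rank-strict : ∀ {x y} → ¬ x ≼ y → rank y < rank x
  rank-strict {x} {y} x⋠y with ≼-total x y
  ... | inj₁ x≼y = contradiction x≼y x⋠y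
  ... | inj₂ y≼x = count-strict _ _
    (λ z z≼y → dec-true (z ≼? x) (≼-trans (fromDoes (z ≼? y) z≼y) y≼x))
    x (dec-true (x ≼? x) (≼-refl x)) (dec-false (x ≼? y) x⋠y)

  ≼⇔rank : ∀ x y → x ≼ y ⇔ rank x ≤ rank y
  ≼⇔rank x y = mk⇔ rank-mono rank⇒≼
    where
    rank⇒≼ : rank x ≤ rank y → x ≼ y
    rank⇒≼ r≤ with x ≼? y
    ... | yes x≼y = x≼y
    ... | no  x⋠y = contradiction r≤ (ℕP.<⇒≱ (rank-strict x⋠y))

  ≐-upSets-rank : F ≐ upSets rank
  ≐-upSets-rank U = ≡-from-⇔
    (λ U-open → upSet⇒open rank U λ x y x∈U r≤ →
       Equivalence.from (≼⇔rank x y) r≤ U U-open x∈U)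
    (λ U-up → upSet-open U λ x y x∈U x≼y →
       open⇒upSet rank U U-up x y x∈U (Equivalence.to (≼⇔rank x y) x≼y))

-- Pigeonhole: an injective self-map of a finite set is onto (a missed value
-- would give an injection Fin (suc k) → Fin k by omitting it).
injective⇒onto : ∀ {k} (h : Fin k → Fin k) → Injective _≡_ _≡_ h → ∀ y → ∃ λ x → h x ≡ y
injective⇒onto {suc k} h h-inj y with FinP.any? (λ x → h x FinP.≟ y)
... | yes hit  = hit
... | no  miss = contradiction (FinP.injective⇒≤ squeeze-inj) (ℕP.<-irrefl refl)
  where
  squeeze : Fin (suc k) → Fin k
  squeeze x = punchOut {i = y} {j = h x} λ y≡hx → miss (x , sym y≡hx)
  squeeze-inj : Injective _≡_ _≡_ squeeze
  squeeze-inj {x} {x′} eq = h-inj (FinP.punchOut-injective {i = y} (λ e → miss (x , sym e)) (λ e → miss (x′ , sym e)) eq)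

Surjection-values : ∀ {n k} → (g : Surjection n k) → ∀ v → v < k → ∃ λ x → toℕ (proj₁ g x) ≡ v
Surjection-values (g , g-onto) v v<k = let (x , gx≡v) = g-onto (fromℕ< v<k) in
  x , trans (cong toℕ gx≡v) (FinP.toℕ-fromℕ< v<k)

level : ∀ {n k} → Surjection n k → Fin n → ℕ
level (g , _) x = toℕ (g x)

values-≤ : ∀ {n} (f f' : Fin n → ℕ) → (∀ y z → f y ≡ f z → f' y ≡ f' z) →
  ∀ t t' → (∀ v → v < t' → ∃ λ y → f' y ≡ v) → (∀ y → f' y < t' → f y < t) → t' ≤ t
values-≤ f f' fine t t' onto below = FinP.injective⇒≤ {f = h} h-inj
  where
  pick : Fin t' → Fin _
  pick v = proj₁ (onto (toℕ v) (FinP.toℕ<n v))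
  pick-spec : ∀ v → f' (pick v) ≡ toℕ v
  pick-spec v = proj₂ (onto (toℕ v) (FinP.toℕ<n v))
  pick-below : ∀ v → f (pick v) < t
  pick-below v = below (pick v) (subst (_< t') (sym (pick-spec v)) (FinP.toℕ<n v))
  h : Fin t' → Fin t
  h v = fromℕ< (pick-below v)
  h-inj : Injective _≡_ _≡_ h
  h-inj {v} {w} hv≡hw = FinP.toℕ-injective (begin
    toℕ v          ≡⟨ pick-spec v ⟨
    f' (pick v)    ≡⟨ fine _ _ (FinP.fromℕ<-injective _ _ (pick-below v) (pick-below w) hv≡hw) ⟩
    f' (pick w)    ≡⟨ pick-spec w ⟩
    toℕ w          ∎)
    where open ≡-Reasoning

SameOrder-sym : ∀ {n} {f g : Fin n → ℕ} → SameOrder f g → SameOrder g f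
SameOrder-sym f∼g x y = mk⇔ (Equivalence.from (f∼g x y)) (Equivalence.to (f∼g x y))

SameOrder-≡ : ∀ {n} {f g : Fin n → ℕ} → SameOrder f g → ∀ x y → f x ≡ f y → g x ≡ g y
SameOrder-≡ f∼g x y fx≡fy = ℕP.≤-antisym (Equivalence.to (f∼g x y) (ℕP.≤-reflexive fx≡fy))
                                         (Equivalence.to (f∼g y x) (ℕP.≤-reflexive (sym fx≡fy)))

SameOrder-< : ∀ {n} {f g : Fin n → ℕ} → SameOrder f g → ∀ x y → g x < g y → f x < f y
SameOrder-< f∼g x y gx<gy = ℕP.≰⇒> λ fy≤fx → ℕP.<⇒≱ gx<gy (Equivalence.to (f∼g y x) fy≤fx)

ranking-≤ : ∀ {n k k'} (g : Surjection n k) (g' : Surjection n k') →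
  SameOrder (level g) (level g') → (k' ≤ k) × (∀ x → level g' x ≤ level g x)
ranking-≤ {k = k} {k'} g g' g∼g' =
  values-≤ (level g) (level g') (SameOrder-≡ g∼g') k k' (Surjection-values g')
           (λ y _ → FinP.toℕ<n (proj₁ g y)) ,
  λ x → values-≤ (level g) (level g') (SameOrder-≡ g∼g') (level g x) (level g' x)
           (λ v v< → Surjection-values g' v (ℕP.<-trans v< (FinP.toℕ<n (proj₁ g' x))))
           (λ y → SameOrder-< g∼g' y x)

ranking-unique : ∀ {n k k'} (g : Surjection n k) (g' : Surjection n k') →
  SameOrder (level g) (level g') → (k ≡ k') × (∀ x → level g x ≡ level g' x)
ranking-unique g g' g∼g' =
  let (k'≤k , g'≤g) = ranking-≤ g g' g∼g' ; (k≤k' , g≤g') = ranking-≤ g' g (SameOrder-sym g∼g')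
  in ℕP.≤-antisym k≤k' k'≤k , λ x → ℕP.≤-antisym (g≤g' x) (g'≤g x)

-- Existence: every rank f is order-equivalent to a ranking, its dense rank
-- x ↦ #{distinct values of f below f x}.  Distinct values are counted by
-- their canonical points (the first point carrying the value).
module DenseRank {n : ℕ} (f : Fin n → ℕ) where

  Canonical : Fin n → Set
  Canonical c = ∀ z → z <ᶠ c → f z ≢ f c

  canonical? : ∀ c → Dec (Canonical c)
  canonical? c = FinP.all? λ z → (z FinP.<? c) →-dec ¬? (f z ℕP.≟ f c)

  canonical-unique : ∀ {c c'} → Canonical c → Canonical c' → f c ≡ f c' → c ≡ c'
  canonical-unique {c} {c'} can can' fc≡fc' with FinP.<-cmp c c'
  ... | tri< c<c' _ _ = contradiction fc≡fc' (can' c c<c')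
  ... | tri≈ _ c≡c' _ = c≡c'
  ... | tri> _ _ c'<c = contradiction (sym fc≡fc') (can c' c'<c)

  -- Every value has a canonical point: descend to earlier points with the
  -- same value while there are any.
  canonical-point : ∀ y → ∃ λ c → Canonical c × f c ≡ f y
  canonical-point y = descend y (<-wellFounded y)
    where
    descend : ∀ y → Acc _<ᶠ_ y → ∃ λ c → Canonical c × f c ≡ f y
    descend y (acc earlier) with FinP.any? (λ z → (z FinP.<? y) ×-dec (f z ℕP.≟ f y))
    ... | yes (z , z<y , fz≡fy) = let (c , can , fc≡fz) = descend z (earlier z<y) in
                                  c , can , trans fc≡fz fz≡fy
    ... | no  none = y , (λ z z<y fz≡fy → none (z , z<y , fz≡fy)) , refl

  canonicalBelow : ℕ → Fin n → Bool
  canonicalBelow t y = does (canonical? y ×-dec (f y <? t))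

  dense : Fin n → ℕ
  dense x = count (canonicalBelow (f x))

  -- the number of distinct values of f
  classes : ℕ
  classes = count (does ∘ canonical?)

  dense-mono : ∀ {x y} → f x ≤ f y → dense x ≤ dense y
  dense-mono {x} {y} fx≤fy = count-mono _ _ λ z z∈ →
    let (can , fz<fx) = fromDoes (canonical? z ×-dec (f z <? f x)) z∈ in
    dec-true (canonical? z ×-dec (f z <? f y)) (can , ℕP.<-≤-trans fz<fx fx≤fy)

  -- the canonical point of y is counted below x (when f y < f x) but not below y
  dense-strict : ∀ {x y} → f y < f x → dense y < dense x
  dense-strict {x} {y} fy<fx with canonical-point y
  ... | c , can , fc≡fy = count-strict _ _
    (λ z z∈ → let (can' , fz<fy) = fromDoes (canonical? z ×-dec (f z <? f y)) z∈ in
              dec-true (canonical? z ×-dec (f z <? f x)) (can' , ℕP.<-trans fz<fy fy<fx))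
    c (dec-true (canonical? c ×-dec (f c <? f x)) (can , subst (_< f x) (sym fc≡fy) fy<fx))
    (dec-false (canonical? c ×-dec (f c <? f y)) λ (_ , fc<fy) → ℕP.<-irrefl fc≡fy fc<fy)

  dense-sameOrder : SameOrder f dense
  dense-sameOrder x y = mk⇔ dense-mono
    (λ dx≤dy → ℕP.≮⇒≥ λ fy<fx → ℕP.<⇒≱ (dense-strict fy<fx) dx≤dy)

  dense<classes : ∀ x → dense x < classes
  dense<classes x with canonical-point x
  ... | c , can , fc≡fx = count-strict _ _
    (λ z z∈ → dec-true (canonical? z) (proj₁ (fromDoes (canonical? z ×-dec (f z <? f x)) z∈)))
    c (dec-true (canonical? c) can)
    (dec-false (canonical? c ×-dec (f c <? f x)) λ (_ , fc<fx) → ℕP.<-irrefl fc≡fx fc<fx)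

  denseFin : Fin n → Fin classes
  denseFin x = fromℕ< (dense<classes x)

  -- Onto: restricted to the canonical points, which are enumerated by
  -- Fin classes, denseFin is injective, hence onto by pigeonhole.
  denseFin-onto : ∀ j → ∃ λ x → denseFin x ≡ j
  denseFin-onto j =
    let (i , hi≡j) = injective⇒onto h h-inj j in point i , hi≡j
    where
    enum : HasSize (Members (does ∘ canonical?)) SameMember classes
    enum = size-members (does ∘ canonical?)
    point : Fin classes → Fin n
    point i = proj₁ (proj₁ enum i)
    point-canonical : ∀ i → Canonical (point i)
    point-canonical i = fromDoes (canonical? (point i)) (proj₂ (proj₁ enum i))
    h : Fin classes → Fin classes
    h i = denseFin (point i)
    h-inj : Injective _≡_ _≡_ h
    h-inj {i} {i'} hi≡hi' = proj₂ (proj₂ enum) i i'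
      (canonical-unique (point-canonical i) (point-canonical i')
        (SameOrder-≡ (SameOrder-sym dense-sameOrder) _ _
          (FinP.fromℕ<-injective _ _ (dense<classes _) (dense<classes _) hi≡hi')))

  ranking : Surjection n classes
  ranking = denseFin , denseFin-onto

  ranking-sameOrder : SameOrder f (level ranking)
  ranking-sameOrder x y = subst₂ (λ a b → f x ≤ f y ⇔ a ≤ b)
    (sym (FinP.toℕ-fromℕ< (dense<classes x))) (sym (FinP.toℕ-fromℕ< (dense<classes y)))
    (dense-sameOrder x y)

SameLevels : ∀ {n k k'} → Surjection n k → Surjection n k' → Set
SameLevels g g' = ∀ x → level g x ≡ level g' x

size-levels : ∀ {n k c} → HasSize (Surjection n k) SameFun c → HasSize (Surjection n k) SameLevels c
size-levels = size-transport (λ e e' x → trans (e x) (e' x)) (λ g → g)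
  (λ _ _ g≗g' x → cong toℕ (g≗g' x)) (λ _ _ e x → FinP.toℕ-injective (e x)) (λ g → g , λ _ → refl)

≗⇒SameOrder : ∀ {n} {f g : Fin n → ℕ} → (∀ x → f x ≡ g x) → SameOrder f g
≗⇒SameOrder f≗g x y = subst₂ (λ a b → _ ⇔ a ≤ b) (f≗g x) (f≗g y) (mk⇔ (λ le → le) (λ le → le))

rankingTop : ∀ {n N} → Σ≤ (Surjection n) N → CompleteTop n
rankingTop (_ , _ , _ , g) = rankTop (level g)

rankingTop-onto : ∀ {n} → 1 ≤ n → ∀ T → ∃ λ r → SameTop (rankingTop {n} {n} r) T
rankingTop-onto {n} n≥1 (F , top , complete) =
  (classes , 1≤classes , count≤n _ , ranking) ,
  λ U → trans (upSets-cong _ _ (SameOrder-sym ranking-sameOrder) U) (sym (≐-upSets-rank U))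
  where
  open CompleteTopology F top complete
  open DenseRank rank
  1≤classes : 1 ≤ classes
  1≤classes = ℕP.≤-trans (s≤s z≤n) (FinP.toℕ<n (denseFin (fromℕ< n≥1)))

size-CompleteTop : ∀ {n} → 1 ≤ n → (surj : ℕ → ℕ) →
  (∀ k → HasSize (Surjection n k) SameFun (surj k)) → HasSize (CompleteTop n) SameTop (Σ₁ n surj)
size-CompleteTop {n} n≥1 surj size-surj =
  size-transport (λ e e' U → trans (e U) (e' U)) rankingTop
    (λ _ _ (_ , g≗g') → upSets-cong _ _ (≗⇒SameOrder g≗g'))
    (λ (_ , _ , _ , g) (_ , _ , _ , g') same → ranking-unique g g' (upSets-sameOrder _ _ same))
    (rankingTop-onto n≥1)
    (size-Σ≤ (λ _ _ → refl) (λ e e' x → trans (e x) (e' x)) (size-levels ∘ size-surj) n)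

SamePartition-sym : ∀ {n k} {b b' : Surjection n k} → SamePartition b b' → SamePartition b' b
SamePartition-sym e i j = mk⇔ (Equivalence.from (e i j)) (Equivalence.to (e i j))

SamePartition-trans : ∀ {n k} {b b' b'' : Surjection n k} →
  SamePartition b b' → SamePartition b' b'' → SamePartition b b''
SamePartition-trans e e' i j = mk⇔ (Equivalence.to (e' i j) ∘′ Equivalence.to (e i j))
                                   (Equivalence.from (e i j) ∘′ Equivalence.from (e' i j))

SameFun⇒SamePartition : ∀ {n k} {b b' : Surjection n k} → SameFun b b' → SamePartition b b'
SameFun⇒SamePartition {b = f , _} {g , _} f≗g i j =
  mk⇔ (λ fi≡fj → trans (sym (f≗g i)) (trans fi≡fj (f≗g j)))
      (λ gi≡gj → trans (f≗g i) (trans gi≡gj (sym (f≗g j))))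

-- A surjective self-map π of Fin k is injective: a section s of π is
-- injective, hence onto by pigeonhole, so s ∘ π is the identity.
onto⇒injective : ∀ {k} (π : Surjection k k) → Injective _≡_ _≡_ (proj₁ π)
onto⇒injective {k} (π , π-onto) {x} {x'} πx≡πx' = begin
  x          ≡⟨ s∘π≗id x ⟨
  s (π x)    ≡⟨ cong s πx≡πx' ⟩
  s (π x')   ≡⟨ s∘π≗id x' ⟩
  x'         ∎
  where
  open ≡-Reasoning
  s : Fin k → Fin k
  s y = proj₁ (π-onto y)
  π∘s≗id : ∀ y → π (s y) ≡ y
  π∘s≗id y = proj₂ (π-onto y)
  s-inj : Injective _≡_ _≡_ s
  s-inj {y} {y'} eq = trans (sym (π∘s≗id y)) (trans (cong π eq) (π∘s≗id y'))
  s∘π≗id : ∀ x → s (π x) ≡ x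
  s∘π≗id x with y , refl ← injective⇒onto s s-inj x = cong s (π∘s≗id y)

-- There are k! permutations of Fin k: a permutation of Fin (suc k) is its
-- value a at zero together with a permutation of the remaining values,
-- reinserted around a by punchIn.
size-permutations : ∀ k → HasSize (Surjection k k) SameFun (k !)
size-permutations zero =
  (λ _ → (λ ()) , (λ ())) , (λ _ → zero , (λ ())) , (λ { zero zero _ → refl })
size-permutations (suc k) =
  size-transport {_≈ᴬ_ = _≡_ ×ᴿ SameFun} {_≈ᴮ_ = SameFun}
    (λ e e' i → trans (e i) (e' i)) extend preserve reflect onto
    (size-× {R = _≡_} {S = SameFun} (size-Fin (suc k)) (size-permutations k))
  where
  insert : Fin (suc k) → (Fin k → Fin k) → Fin (suc k) → Fin (suc k)
  insert a π zero    = a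
  insert a π (suc i) = punchIn a (π i)
  extend : Fin (suc k) × Surjection k k → Surjection (suc k) (suc k)
  extend (a , π , π-onto) = insert a π , onto-insert
    where
    onto-insert : ∀ y → ∃ λ x → insert a π x ≡ y
    onto-insert y with a FinP.≟ y
    ... | yes a≡y = zero , a≡y
    ... | no  a≢y = let (i , πi≡y') = π-onto (punchOut a≢y) in
      suc i , trans (cong (punchIn a) πi≡y') (FinP.punchIn-punchOut a≢y)
  preserve : ∀ p q → (_≡_ ×ᴿ SameFun) p q → SameFun (extend p) (extend q)
  preserve _ _ (refl , π≗π') zero    = refl
  preserve _ _ (refl , π≗π') (suc i) = cong (punchIn _) (π≗π' i)
  reflect : ∀ p q → SameFun (extend p) (extend q) → (_≡_ ×ᴿ SameFun) p q
  reflect (a , _) _ same with refl ← same zero =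
    refl , λ i → FinP.punchIn-injective a _ _ (same (suc i))
  onto : ∀ σ → ∃ λ p → SameFun (extend p) σ
  onto (σ , σ-onto) = (σ zero , rest , rest-onto) , reinsert
    where
    σ0≢σsuc : ∀ i → σ zero ≢ σ (suc i)
    σ0≢σsuc i eq with () ← onto⇒injective (σ , σ-onto) eq
    rest : Fin k → Fin k
    rest i = punchOut (σ0≢σsuc i)
    rest-onto : ∀ y → ∃ λ i → rest i ≡ y
    rest-onto y with σ-onto (punchIn (σ zero) y)
    ... | zero  , σ0≡ = contradiction (sym σ0≡) (FinP.punchInᵢ≢i (σ zero) y)
    ... | suc i , σi≡ = i , trans (FinP.punchOut-cong (σ zero) σi≡) (FinP.punchOut-punchIn (σ zero))
    reinsert : SameFun (extend (σ zero , rest , rest-onto)) (σ , σ-onto)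
    reinsert zero    = refl
    reinsert (suc i) = FinP.punchIn-punchOut (σ0≢σsuc i)

-- The labellings with the same blocks as b are exactly π ∘ b for the k!
-- permutations π of the labels.
size-relabellings : ∀ {n k} (b : Surjection n k) →
  HasSize (Σ (Surjection n k) λ b' → SamePartition b' b) (λ x y → SameFun (proj₁ x) (proj₁ y)) (k !)
size-relabellings {n} {k} (b , b-onto) =
  size-transport {_≈ᴬ_ = SameFun} {_≈ᴮ_ = λ x y → SameFun (proj₁ x) (proj₁ y)}
    (λ e e' i → trans (e i) (e' i)) relabel preserve reflect onto (size-permutations k)
  where
  block : Fin k → Fin n
  block v = proj₁ (b-onto v)
  relabel : Surjection k k → Σ (Surjection n k) λ b' → SamePartition b' (b , b-onto)
  relabel (π , π-onto) =
    ((λ i → π (b i)) , λ w → let (v , πv≡w) = π-onto w in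
                             block v , trans (cong π (proj₂ (b-onto v))) πv≡w) ,
    λ i j → mk⇔ (onto⇒injective (π , π-onto)) (cong π)
  preserve : ∀ π π' → SameFun π π' → SameFun (proj₁ (relabel π)) (proj₁ (relabel π'))
  preserve _ _ π≗π' i = π≗π' (b i)
  reflect : ∀ π π' → SameFun (proj₁ (relabel π)) (proj₁ (relabel π')) → SameFun π π'
  reflect (π , _) (π' , _) same v =
    trans (cong π (sym (proj₂ (b-onto v)))) (trans (same (block v)) (cong π' (proj₂ (b-onto v))))
  onto : ∀ x → ∃ λ π → SameFun (proj₁ (relabel π)) (proj₁ x)
  onto ((b' , b'-onto) , b'∼b) = (π , π-onto) , π∘b≗b'
    where
    π : Fin k → Fin k
    π v = b' (block v)
    π∘b≗b' : ∀ i → π (b i) ≡ b' i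
    π∘b≗b' i = Equivalence.from (b'∼b (block (b i)) i) (proj₂ (b-onto (b i)))
    π-onto : ∀ w → ∃ λ v → π v ≡ w
    π-onto w = let (i , b'i≡w) = b'-onto w in b i , trans (π∘b≗b' i) b'i≡w

surjections-stirling : ∀ {n k s st} → HasSize (Surjection n k) SameFun s →
  HasSize (Surjection n k) SamePartition st → s ≡ st * k !
surjections-stirling size-surj size-part =
  size-unique {_≈_ = SameFun} (λ e i → sym (e i)) (λ e e' i → trans (e i) (e' i)) size-surj
    (size-fibred {R = SameFun} {S = SamePartition}
      (λ {b} {b'} → SameFun⇒SamePartition {b = b} {b'})
      (λ {b} {b'} → SamePartition-sym {b = b} {b'})
      (λ {b} {b'} {b''} → SamePartition-trans {b = b} {b'} {b''})
      size-part size-relabellings)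

image-id : ∀ {n} (U : Subset n) → image idₚ U ≡ U
image-id = tabulate∘lookup

image-flip : ∀ {n} (σ : Permutation′ n) V → image σ (image (flip σ) V) ≡ V
image-flip σ V = trans (tabulate-cong λ y → trans (lookup∘tabulate _ (σ ⟨$⟩ˡ y)) (cong (lookup V) (inverseʳ σ)))
                       (tabulate∘lookup V)

image-∘ₚ : ∀ {n} (σ τ : Permutation′ n) U → image τ (image σ U) ≡ image (σ ∘ₚ τ) U
image-∘ₚ σ τ U = tabulate-cong λ y → lookup∘tabulate _ (τ ⟨$⟩ˡ y)

hom-refl : ∀ {n} {G : Graph n} (T : TopWithGraph n G) → Homeomorphic T T
hom-refl (F , _) = idₚ , λ U → cong F (sym (image-id U))

hom-sym : ∀ {n} {G : Graph n} {T T' : TopWithGraph n G} → Homeomorphic T T' → Homeomorphic T' T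
hom-sym {T = F , _} {F' , _} (σ , F≡F'∘σ) =
  flip σ , λ V → trans (cong F' (sym (image-flip σ V))) (sym (F≡F'∘σ (image (flip σ) V)))

hom-trans : ∀ {n} {G : Graph n} {T T' T'' : TopWithGraph n G} →
  Homeomorphic T T' → Homeomorphic T' T'' → Homeomorphic T T''
hom-trans {T = F , _} {F' , _} {F'' , _} (σ , F≡F'∘σ) (τ , F'≡F''∘τ) =
  σ ∘ₚ τ , λ U → trans (F≡F'∘σ U) (trans (F'≡F''∘τ (image σ U)) (cong F'' (image-∘ₚ σ τ U)))

-- The invariant: which cardinalities occur among the open sets.
HasOpenOfSize : ∀ {n} → Family n → ℕ → Set
HasOpenOfSize {n} F s = ∃ λ (U : Subset n) → Open F U × count (lookup U) ≡ s

hom-HasOpenOfSize : ∀ {n} {G : Graph n} (T T' : TopWithGraph n G) → Homeomorphic T T' →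
  ∀ {s} → HasOpenOfSize (proj₁ T) s → HasOpenOfSize (proj₁ T') s
hom-HasOpenOfSize (F , _) (F' , _) (σ , F≡F'∘σ) (U , U-open , |U|≡s) =
  image σ U , trans (sym (F≡F'∘σ U)) U-open ,
  trans (sym (count-bij (lookup U) (lookup (image σ U)) (σ ⟨$⟩ʳ_) (σ ⟨$⟩ˡ_)
                        (λ _ → inverseʳ σ) (λ _ → inverseˡ σ)
                        (λ x → trans (lookup∘tabulate _ (σ ⟨$⟩ʳ x)) (cong (lookup U) (inverseˡ σ)))))
        |U|≡s

UpClosed : ∀ {n} → (Fin n → Bool) → Set
UpClosed p = ∀ i i' → p i ≡ true → toℕ i ≤ toℕ i' → p i' ≡ true

upClosed-suc : ∀ {n} {p : Fin (suc n) → Bool} → UpClosed p → UpClosed (p ∘ suc)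
upClosed-suc up i i' pi i≤i' = up (suc i) (suc i') pi (s≤s i≤i')

upClosed-above : ∀ {n} (p : Fin n → Bool) → UpClosed p → ∀ i → p i ≡ true → n ∸ count p ≤ toℕ i
upClosed-above {suc n} p up i pi with p zero in p0
... | true  rewrite count-cong (p ∘ suc) (λ _ → true) (λ x → up zero (suc x) p0 z≤n) | count-all n
                  | ℕP.n∸n≡0 n = z≤n
upClosed-above {suc n} p up zero    pi | false with () ← trans (sym pi) p0
upClosed-above {suc n} p up (suc i) pi | false rewrite ℕP.+-∸-assoc 1 (count≤n (p ∘ suc)) =
  s≤s (upClosed-above (p ∘ suc) (upClosed-suc up) i pi)

upClosed-below : ∀ {n} (p : Fin n → Bool) → UpClosed p → ∀ i → n ∸ count p ≤ toℕ i → p i ≡ true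
upClosed-below {suc n} p up i n∸c≤i with p zero in p0
... | true = up zero i p0 z≤n
upClosed-below {suc n} p up zero    n∸c≤i | false
  rewrite ℕP.+-∸-assoc 1 (count≤n (p ∘ suc)) with () ← n∸c≤i
upClosed-below {suc n} p up (suc i) n∸c≤i | false
  rewrite ℕP.+-∸-assoc 1 (count≤n (p ∘ suc)) =
  upClosed-below (p ∘ suc) (upClosed-suc up) i (s≤s⁻¹ n∸c≤i)

count-above : ∀ n t → count {n} (λ i → does (t <? toℕ i)) ≡ n ∸ suc t
count-above zero    t       = refl
count-above (suc n) zero    = trans (count-cong {n} _ (λ _ → true) (λ _ → refl)) (count-all n)
count-above (suc n) (suc t) = count-above n t

-- The staircase of w : Vec Bool m places point i of Fin (suc m) at the
-- height given by the number of true entries among the first i of w;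
-- w records where the staircase steps up.
stairs : ∀ {m} → Vec Bool m → Fin (suc m) → ℕ
stairs w       zero    = 0
stairs (b ∷ w) (suc i) = bit b + stairs w i

stairs-mono : ∀ {m} (w : Vec Bool m) i i' → toℕ i ≤ toℕ i' → stairs w i ≤ stairs w i'
stairs-mono w       zero    i'       _           = z≤n
stairs-mono (b ∷ w) (suc i) (suc i') (s≤s i≤i') = ℕP.+-monoʳ-≤ (bit b) (stairs-mono w i i' i≤i')

stairs-step : ∀ {m} (w : Vec Bool m) j → stairs w (suc j) ≡ stairs w (inject₁ j) + bit (lookup w j)
stairs-step (b ∷ w) zero    = ℕP.+-identityʳ (bit b)
stairs-step (b ∷ w) (suc j) = trans (cong (bit b +_) (stairs-step w j)) (sym (ℕP.+-assoc (bit b) _ _))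

Staircase : ∀ {m} → Vec Bool m → CompleteTop (suc m)
Staircase w = rankTop (stairs w)

-- The staircase of w has an open set with m ∸ j points iff w steps up at j:
-- its open sets are the index thresholds where the height increases.
staircase-step⇒open : ∀ {m} (w : Vec Bool m) j → lookup w j ≡ true →
  HasOpenOfSize (upSets (stairs w)) (m ∸ toℕ j)
staircase-step⇒open {m} w j wj = tabulate above , upSet⇒open (stairs w) _ above-up ,
  trans (count-cong _ above (lookup∘tabulate above)) (count-above (suc m) (toℕ j))
  where
  above : Fin (suc m) → Bool
  above i = does (toℕ j <? toℕ i)
  lower : ∀ y x → toℕ y ≤ toℕ j → toℕ j < toℕ x → stairs w y < stairs w x
  lower y x y≤j j<x = begin-strict
    stairs w y                                 ≤⟨ stairs-mono w y (inject₁ j) (subst (toℕ y ≤_) (sym (FinP.toℕ-inject₁ j)) y≤j) ⟩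
    stairs w (inject₁ j)                       <⟨ ℕP.n<1+n _ ⟩
    suc (stairs w (inject₁ j))                 ≡⟨ ℕP.+-comm 1 _ ⟩
    stairs w (inject₁ j) + bit true            ≡⟨ cong (λ b → stairs w (inject₁ j) + bit b) wj ⟨
    stairs w (inject₁ j) + bit (lookup w j)    ≡⟨ stairs-step w j ⟨
    stairs w (suc j)                           ≤⟨ stairs-mono w (suc j) x j<x ⟩
    stairs w x                                 ∎
    where open ℕP.≤-Reasoning
  above-up : UpSet (stairs w) (tabulate above)
  above-up x y x∈ sx≤sy = Equivalence.from (∈-tabulate above y) (dec-true (toℕ j <? toℕ y)
    (ℕP.≰⇒> λ y≤j → ℕP.<⇒≱ (lower y x y≤j (fromDoes (toℕ j <? toℕ x) (Equivalence.to (∈-tabulate above x) x∈))) sx≤sy))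

-- Conversely an open set of m ∸ j points is the threshold above j, which
-- is an up-set only if the staircase rises between j and j + 1.
staircase-open⇒step : ∀ {m} (w : Vec Bool m) j →
  HasOpenOfSize (upSets (stairs w)) (m ∸ toℕ j) → lookup w j ≡ true
staircase-open⇒step {m} w j (U , U-open , |U|≡m∸j) with lookup w j in wj
... | true  = refl
... | false = contradiction j∈U j∉U
  where
  up : UpSet (stairs w) U
  up = open⇒upSet (stairs w) U U-open
  U-upClosed : UpClosed (lookup U)
  U-upClosed i i' Ui i≤i' = Equivalence.to (∈⇔lookup U i')
    (up i i' (Equivalence.from (∈⇔lookup U i) Ui) (stairs-mono w i i' i≤i'))
  threshold : suc m ∸ count (lookup U) ≡ suc (toℕ j)
  threshold = begin
    suc m ∸ count (lookup U)   ≡⟨ cong (suc m ∸_) |U|≡m∸j ⟩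
    suc m ∸ (m ∸ toℕ j)        ≡⟨ ℕP.+-∸-assoc 1 (ℕP.m∸n≤m m (toℕ j)) ⟩
    suc (m ∸ (m ∸ toℕ j))      ≡⟨ cong suc (ℕP.m∸[m∸n]≡n (ℕP.<⇒≤ (FinP.toℕ<n j))) ⟩
    suc (toℕ j)                ∎
    where open ≡-Reasoning
  sj∈U : lookup U (suc j) ≡ true
  sj∈U = upClosed-below (lookup U) U-upClosed (suc j) (ℕP.≤-reflexive threshold)
  flat : stairs w (suc j) ≤ stairs w (inject₁ j)
  flat = ℕP.≤-reflexive (trans (stairs-step w j)
           (trans (cong (λ b → stairs w (inject₁ j) + bit b) wj) (ℕP.+-identityʳ _)))
  j∈U : lookup U (inject₁ j) ≡ true
  j∈U = Equivalence.to (∈⇔lookup U _)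
    (up (suc j) (inject₁ j) (Equivalence.from (∈⇔lookup U _) sj∈U) flat)
  j∉U : lookup U (inject₁ j) ≢ true
  j∉U j∈U = ℕP.n≮n (toℕ j) (subst₂ _≤_ threshold (FinP.toℕ-inject₁ j)
                              (upClosed-above (lookup U) U-upClosed (inject₁ j) j∈U))

staircase-injective : ∀ {m} (w w' : Vec Bool m) → Homeomorphic (Staircase w) (Staircase w') → w ≡ w'
staircase-injective w w' w≅w' = begin
  w                     ≡⟨ tabulate∘lookup w ⟨
  tabulate (lookup w)   ≡⟨ tabulate-cong same-steps ⟩
  tabulate (lookup w')  ≡⟨ tabulate∘lookup w' ⟩
  w'                    ∎
  where
  open ≡-Reasoning
  w'≅w : Homeomorphic (Staircase w') (Staircase w)
  w'≅w = hom-sym {T = Staircase w} {Staircase w'} w≅w'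
  same-steps : ∀ j → lookup w j ≡ lookup w' j
  same-steps j = ≡-from-⇔
    (λ wj → staircase-open⇒step w' j
       (hom-HasOpenOfSize (Staircase w) (Staircase w') w≅w' (staircase-step⇒open w j wj)))
    (λ w'j → staircase-open⇒step w j
       (hom-HasOpenOfSize (Staircase w') (Staircase w) w'≅w (staircase-step⇒open w' j w'j)))

-- Sorting the points of Fin n by a rank f: the position of x is the number
-- of points before it in the strict total order "by rank, then by index";
-- this is a permutation σ after which the rank becomes monotone.
module Sorting {n : ℕ} (f : Fin n → ℕ) where
  private module Lex = StrictTotalOrder (×-strictTotalOrder ℕP.<-strictTotalOrder ℕP.<-strictTotalOrder)

  key : Fin n → ℕ × ℕ
  key x = f x , toℕ x

  _⊏_ : Fin n → Fin n → Set
  y ⊏ x = key y Lex.< key x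

  -- before x y: the point y comes before x
  before : Fin n → Fin n → Bool
  before x y = does (key y Lex.<? key x)

  position : Fin n → ℕ
  position x = count (before x)

  -- everything before y is before x, and y itself is only before x
  position-strict : ∀ {x y} → y ⊏ x → position y < position x
  position-strict {x} {y} y⊏x = count-strict _ _
    (λ z z⊏y → dec-true (key z Lex.<? key x) (Lex.trans (fromDoes (key z Lex.<? key y) z⊏y) y⊏x))
    y (dec-true (key y Lex.<? key x) y⊏x) (dec-false (key y Lex.<? key y) (Lex.irrefl (refl , refl)))

  -- x is not before itself
  position<n : ∀ x → position x < n
  position<n x = subst (position x <_) (count-all n)
    (count-strict _ (λ _ → true) (λ _ _ → refl) x refl (dec-false (key x Lex.<? key x) (Lex.irrefl (refl , refl))))

  sortFin : Fin n → Fin n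
  sortFin x = fromℕ< (position<n x)

  toℕ-sortFin : ∀ x → toℕ (sortFin x) ≡ position x
  toℕ-sortFin x = FinP.toℕ-fromℕ< (position<n x)

  sortFin⇒position : ∀ {x y} → sortFin x ≡ sortFin y → position x ≡ position y
  sortFin⇒position {x} {y} eq = trans (sym (toℕ-sortFin x)) (trans (cong toℕ eq) (toℕ-sortFin y))

  sortFin-injective : Injective _≡_ _≡_ sortFin
  sortFin-injective {x} {y} eq with Lex.compare (key x) (key y)
  ... | tri< x⊏y _ _ = contradiction (position-strict x⊏y) (ℕP.<-irrefl (sortFin⇒position eq))
  ... | tri≈ _ (_ , same-index) _ = FinP.toℕ-injective same-index
  ... | tri> _ _ y⊏x = contradiction (position-strict y⊏x) (ℕP.<-irrefl (sortFin⇒position (sym eq)))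

  unsort : Fin n → Fin n
  unsort i = proj₁ (injective⇒onto sortFin sortFin-injective i)

  sortFin∘unsort : ∀ i → sortFin (unsort i) ≡ i
  sortFin∘unsort i = proj₂ (injective⇒onto sortFin sortFin-injective i)

  σ : Permutation′ n
  σ = permutation sortFin unsort sortFin∘unsort (λ x → sortFin-injective (sortFin∘unsort (sortFin x)))

  sorted-monotone : ∀ i i' → toℕ i ≤ toℕ i' → f (σ ⟨$⟩ˡ i) ≤ f (σ ⟨$⟩ˡ i')
  sorted-monotone i i' i≤i' = ℕP.≮⇒≥ λ fi'<fi → ℕP.<⇒≱ (subst₂ _<_ (index i') (index i)
    (position-strict (inj₁ fi'<fi))) i≤i'
    where
    index : ∀ i → position (unsort i) ≡ toℕ i
    index i = trans (sym (toℕ-sortFin (unsort i))) (cong toℕ (sortFin∘unsort i))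

Monotone : ∀ {m} → (Fin (suc m) → ℕ) → Set
Monotone h = ∀ i i' → toℕ i ≤ toℕ i' → h i ≤ h i'

monotone-suc : ∀ {m} {h : Fin (suc (suc m)) → ℕ} → Monotone h → Monotone (h ∘ suc)
monotone-suc mono i i' i≤i' = mono (suc i) (suc i') (s≤s i≤i')

stepsOf : ∀ {m} → (Fin (suc m) → ℕ) → Vec Bool m
stepsOf {zero}  h = []
stepsOf {suc m} h = does (h zero <? h (suc zero)) ∷ stepsOf (h ∘ suc)

stairs-mono-≤ : ∀ {m} (h : Fin (suc m) → ℕ) → Monotone h →
  ∀ i i' → h i ≤ h i' → stairs (stepsOf h) i ≤ stairs (stepsOf h) i'
stairs-mono-≤ h mono zero i' _ = z≤n
stairs-mono-≤ {suc m} h mono (suc i) zero hi≤h0 = flat-start (h zero <? h (suc zero))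
  where
  -- h is constant on [0, suc i]: no step at 0, and the tail returns to its start
  flat-start : (d : Dec (h zero < h (suc zero))) → bit (does d) + stairs (stepsOf (h ∘ suc)) i ≤ 0
  flat-start (yes h0<h1) = contradiction (ℕP.≤-trans (mono (suc zero) (suc i) (s≤s z≤n)) hi≤h0) (ℕP.<⇒≱ h0<h1)
  flat-start (no  _)     = stairs-mono-≤ (h ∘ suc) (monotone-suc mono) i zero
                             (ℕP.≤-trans hi≤h0 (mono zero (suc zero) z≤n))
stairs-mono-≤ {suc m} h mono (suc i) (suc i') hi≤hi' =
  ℕP.+-monoʳ-≤ (bit (does (h zero <? h (suc zero))))
    (stairs-mono-≤ (h ∘ suc) (monotone-suc mono) i i' hi≤hi')

stairs-mono-≥ : ∀ {m} (h : Fin (suc m) → ℕ) → Monotone h →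
  ∀ i i' → stairs (stepsOf h) i ≤ stairs (stepsOf h) i' → h i ≤ h i'
stairs-mono-≥ h mono zero i' _ = mono zero i' z≤n
stairs-mono-≥ {suc m} h mono (suc i) zero = flat-start (h zero <? h (suc zero))
  where
  -- the staircase does not rise up to suc i, so neither does h
  flat-start : (d : Dec (h zero < h (suc zero))) → bit (does d) + stairs (stepsOf (h ∘ suc)) i ≤ 0 →
               h (suc i) ≤ h zero
  flat-start (yes _)    ()
  flat-start (no h0≮h1) flat =
    ℕP.≤-trans (stairs-mono-≥ (h ∘ suc) (monotone-suc mono) i zero flat) (ℕP.≮⇒≥ h0≮h1)
stairs-mono-≥ {suc m} h mono (suc i) (suc i') si≤si' =
  stairs-mono-≥ (h ∘ suc) (monotone-suc mono) i i'
    (ℕP.+-cancelˡ-≤ (bit (does (h zero <? h (suc zero)))) _ _ si≤si')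

monotone-sameOrder : ∀ {m} (h : Fin (suc m) → ℕ) → Monotone h → SameOrder h (stairs (stepsOf h))
monotone-sameOrder h mono i i' = mk⇔ (stairs-mono-≤ h mono i i') (stairs-mono-≥ h mono i i')

-- Every topology with complete graph is homeomorphic to a staircase:
-- relabel its points in sorted order of rank.
homeomorphic-staircase : ∀ {m} (T : CompleteTop (suc m)) → ∃ λ w → Homeomorphic T (Staircase w)
homeomorphic-staircase (F , top , complete) = stepsOf sorted , σ , λ U → begin
  F U                                           ≡⟨ ≐-upSets-rank U ⟩
  upSets rank U                                 ≡⟨ upSets-image rank σ U ⟩
  upSets sorted (image σ U)                     ≡⟨ upSets-cong sorted _ sorted∼stairs (image σ U) ⟩
  upSets (stairs (stepsOf sorted)) (image σ U)  ∎
  where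
  open CompleteTopology F top complete
  open Sorting rank
  open ≡-Reasoning
  sorted : Fin _ → ℕ
  sorted i = rank (σ ⟨$⟩ˡ i)
  sorted∼stairs : SameOrder sorted (stairs (stepsOf sorted))
  sorted∼stairs = monotone-sameOrder sorted sorted-monotone

size-Bool : HasSize Bool _≡_ 2
size-Bool = (λ { zero → true ; (suc zero) → false }) ,
            (λ { true → zero , refl ; false → suc zero , refl }) ,
            (λ { zero zero _ → refl ; zero (suc zero) () ; (suc zero) zero () ; (suc zero) (suc zero) _ → refl })

size-Vec-Bool : ∀ m → HasSize (Vec Bool m) _≡_ (2 ^ m)
size-Vec-Bool zero    = (λ _ → []) , (λ { [] → zero , refl }) , (λ { zero zero _ → refl })
size-Vec-Bool (suc m) =
  size-transport {_≈ᴬ_ = _≡_ ×ᴿ _≡_} {_≈ᴮ_ = _≡_} trans (λ (b , w) → b ∷ w)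
    (λ { _ _ (refl , refl) → refl }) (λ { (b , w) (.b , .w) refl → refl , refl })
    (λ { (b ∷ w) → (b , w) , refl })
    (size-× {R = _≡_} {S = _≡_} size-Bool (size-Vec-Bool m))

size-homeomorphism-classes : ∀ m → HasSize (CompleteTop (suc m)) Homeomorphic (2 ^ m)
size-homeomorphism-classes m =
  size-transport {_≈ᴬ_ = _≡_} (λ {T} {T'} {T''} → hom-trans {T = T} {T'} {T''}) Staircase
    (λ { w .w refl → hom-refl (Staircase w) }) staircase-injective
    (λ T → let (w , T≅w) = homeomorphic-staircase T in w , hom-sym {T = T} {Staircase w} T≅w)
    (size-Vec-Bool m)

Σ₁-cong : ∀ N {f g : ℕ → ℕ} → (∀ k → f k ≡ g k) → Σ₁ N f ≡ Σ₁ N g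
Σ₁-cong zero    f≗g = refl
Σ₁-cong (suc N) f≗g = cong₂ _+_ (Σ₁-cong N f≗g) (f≗g (suc N))

theorem4p3 : (n : ℕ) → 1 ≤ n →
    (surj stir : ℕ → ℕ) → (τ̄Kn ħKn : ℕ) →
    (∀ k → HasSize (Surjection n k) SameFun (surj k)) →
    (∀ k → HasSize (Surjection n k) SamePartition (stir k)) →
    HasSize (TopWithGraph n (CompleteGraph n)) SameTop τ̄Kn →
    HasSize (TopWithGraph n (CompleteGraph n)) Homeomorphic ħKn →
    (τ̄Kn ≡ Σ₁ n surj) × (Σ₁ n surj ≡ Σ₁ n (λ k → stir k * k !)) × (ħKn ≡ 2 ^ (n ∸ 1))
theorem4p3 zero    ()
theorem4p3 (suc m) n≥1 surj stir τ̄Kn ħKn size-surj size-part size-τ̄ size-ħ =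
  size-unique (λ e U → sym (e U)) (λ e e' U → trans (e U) (e' U))
              size-τ̄ (size-CompleteTop n≥1 surj size-surj) ,
  Σ₁-cong (suc m) (λ k → surjections-stirling (size-surj k) (size-part k)) ,
  size-unique (λ {T} {T'} → hom-sym {T = T} {T'}) (λ {T} {T'} {T''} → hom-trans {T = T} {T'} {T''})
              size-ħ (size-homeomorphism-classes m)
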